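{- Let $m,n,k$ be nonnegative integers with $m+n>2k$. If $k>0$, then $$\sum_{l=0}^{m+n-2k}\binom{n+m-2k}{l}(-1)^l\xi_{l+2k,q}=q^2\sum_{l=0}^{2k}\binom{2k}{l}(-1)^{l+2k}\xi_{n+m-l,1/q}.$$ Moreover (case $k=0$, i.e. $m+n>0$), $$\sum_{l=0}^{m+n}\binom{n+m}{l}(-1)^l\xi_{l,q}=q^2\xi_{n+m,1/q}+[2]_q.$$
   Context: Let $p$ be an odd prime, $\mathbb{C}_p$ the completion of an algebraic closure of $\mathbb{Q}_p$, and $q\in\mathbb{C}_p$ with $|1-q|_p<1$ (then also $|1-q^{ -1}|_p<1$). Put $[2]_q=1+q$. For $Q\in\{q,q^{ -1}\}$ the $Q$-Euler numbers $\xi_{n,Q}$ are defined by $\xi_{0,Q}=1$ and, for $n\ge 1$, $Q\sum_{l=0}^{n}\binom{n}{l}Q^l\xi_{l,Q}+\xi_{n,Q}=0$; $\xi_{n,1/q}$ denotes these numbers for $Q=q^{ -1}$. -}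

module Defs where

open import Level using (Level)
open import Data.Nat using (ℕ; zero; suc)
open import Data.Nat.Combinatorics using (_C_)
open import Algebra.Bundles using (CommutativeRing)

module Ops {c ℓ : Level} (R : CommutativeRing c ℓ) where
  open CommutativeRing R

  ι : ℕ → Carrier
  ι zero    = 0#
  ι (suc n) = 1# + ι n

  infixr 8 _^_
  _^_ : Carrier → ℕ → Carrier
  x ^ zero  = 1#
  x ^ suc n = x * (x ^ n)

  Σ≤ : ℕ → (ℕ → Carrier) → Carrier
  Σ≤ zero    f = f 0
  Σ≤ (suc n) f = Σ≤ n f + f (suc n)

  binom : ℕ → ℕ → Carrier
  binom n l = ι (n C l)

  sgn : ℕ → Carrier
  sgn l = (- 1#) ^ l

  record IsQEuler (Q : Carrier) (ξ : ℕ → Carrier) : Set (c Level.⊔ ℓ) where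
    field
      init : ξ 0 ≈ 1#
      rec  : ∀ n → Q * Σ≤ (suc n) (λ l → binom (suc n) l * (Q ^ l * ξ l)) + ξ (suc n) ≈ 0#

{-# OPTIONS --safe #-}
module Submission where

open import Defs
open import Data.Nat using (ℕ; zero; suc; _<_; _≤_; _≤?_; z≤n; s≤s)
  renaming (_+_ to _+ₙ_; _*_ to _*ₙ_; _∸_ to _∸ₙ_)
import Data.Nat.Properties as ℕ
open import Data.Nat.Induction using (<-rec)
open import Data.Nat.Combinatorics using (_C_; nCk+nC[k+1]≡[n+1]C[k+1])
open import Data.Nat.Combinatorics.Specification using (k>n⇒nCk≡0)
open import Data.Integer as ℤ using (ℤ; +_; -[1+_]; _⊖_; _◃_; sign; ∣_∣; 1ℤ)
import Data.Integer.Properties as ℤ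
open import Data.Sign as Sign using (Sign)
open import Data.Maybe using (just; nothing)
open import Data.Product using (_×_; _,_)
open import Level using (_⊔_)
open import Relation.Nullary using (yes; no)
open import Relation.Binary.Definitions using (WeaklyDecidable)
open import Algebra.Bundles using (CommutativeRing)
open import Algebra.Solver.Ring.AlmostCommutativeRing
  using (AlmostCommutativeRing; fromCommutativeRing; _-Raw-AlmostCommutative⟶_; Induced-equivalence)
import Relation.Binary.PropositionalEquality as ≡

-- Write E for the shift u ↦ u ∘ suc and read sequences umbrally. The Euler
-- recurrence for Q says Q (Q E + 1)ⁿ ξ + ξ n = (1 + Q) δₙ, and it determines ξ
-- as soon as every 1 + Qⁿ⁺¹ is cancellable; for Q = q⁻¹ this follows from
-- q⁻ⁿ⁻¹ (1 + qⁿ⁺¹) = 1 + q⁻ⁿ⁻¹. Put η n = (1 − E)ⁿ ξ. Composing umbral powers,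
-- (q⁻¹ E + 1)ⁿ η = (1 + q⁻¹ − q⁻¹ E)ⁿ ξ, which the q-recurrence evaluates; with
-- this, q⁻² (η n − (1 + q) + (q² + q) δₙ) solves the q⁻¹-recurrence, hence is
-- ξ⁻¹ n. For n > 0 that is the case k = 0. For k > 0 substitute it into the
-- right-hand side: the constants cancel because Σₗ C(s,l) (−1)ˡ = 0, and
-- Σₗ C(s,l) (−1)ˡ (1 − E)^(N−l) = (1 − E)^(N−s) ((1 − E) − 1)ˢ = Eˢ (1 − E)^(N−s)
-- for even s.

-- The ring solver with the carrier itself as coefficients cannot prove
-- identities that need coefficient arithmetic such as 1 − 1 = 0, since the
-- equality of R is not decidable; integer coefficients compute.
module IntegerCoefficientRingSolver {c ℓ} (R : CommutativeRing c ℓ) where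
  open CommutativeRing R
  open import Algebra.Properties.Semiring.Mult.TCOptimised semiring
    using (×-homo-+; ×1-homo-*) renaming (_×_ to _·1_)
  open import Algebra.Properties.Ring ring using (-1*x≈-x)
  open import Algebra.Properties.Group +-group using (⁻¹-involutive; ε⁻¹≈ε; //-rightDividesʳ)
  open import Algebra.Properties.AbelianGroup +-abelianGroup using (⁻¹-∙-comm; ⁻¹-anti-homo‿-)
  open import Algebra.Properties.CommutativeSemigroup *-commutativeSemigroup using (interchange)
  open import Relation.Binary.Reasoning.Setoid setoid

  ℕ⟦_⟧ : ℕ → Carrier
  ℕ⟦ n ⟧ = n ·1 1#

  ℕ⟦∸⟧ : ∀ {m n} → n ≤ m → ℕ⟦ m ∸ₙ n ⟧ ≈ ℕ⟦ m ⟧ - ℕ⟦ n ⟧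
  ℕ⟦∸⟧ {m} {n} n≤m = begin
    ℕ⟦ m ∸ₙ n ⟧                        ≈⟨ //-rightDividesʳ _ _ ⟨
    (ℕ⟦ m ∸ₙ n ⟧ + ℕ⟦ n ⟧) - ℕ⟦ n ⟧    ≈⟨ +-congʳ (×-homo-+ 1# (m ∸ₙ n) n) ⟨
    ℕ⟦ m ∸ₙ n +ₙ n ⟧ - ℕ⟦ n ⟧         ≡⟨ ≡.cong (λ k → ℕ⟦ k ⟧ - ℕ⟦ n ⟧) (ℕ.m∸n+n≡m n≤m) ⟩
    ℕ⟦ m ⟧ - ℕ⟦ n ⟧                     ∎

  σ⟦_⟧ : Sign → Carrier
  σ⟦ Sign.+ ⟧ = 1#
  σ⟦ Sign.- ⟧ = - 1#

  ⟦_⟧ : ℤ → Carrier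
  ⟦ + n ⟧      = ℕ⟦ n ⟧
  ⟦ -[1+ n ] ⟧ = - ℕ⟦ suc n ⟧

  ⟦-⟧ : ∀ i → ⟦ ℤ.- i ⟧ ≈ - ⟦ i ⟧
  ⟦-⟧ -[1+ n ]     = sym (⁻¹-involutive _)
  ⟦-⟧ (+ zero)     = sym ε⁻¹≈ε
  ⟦-⟧ (+ suc n)    = refl

  ⟦⊖⟧ : ∀ m n → ⟦ m ⊖ n ⟧ ≈ ℕ⟦ m ⟧ - ℕ⟦ n ⟧
  ⟦⊖⟧ m n with n ≤? m
  ... | yes n≤m = trans (reflexive (≡.cong ⟦_⟧ (ℤ.⊖-≥ n≤m))) (ℕ⟦∸⟧ n≤m)
  ... | no  n≰m = begin
    ⟦ m ⊖ n ⟧                    ≡⟨ ≡.cong ⟦_⟧ (ℤ.⊖-< (ℕ.≰⇒> n≰m)) ⟩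
    ⟦ ℤ.- (+ (n ∸ₙ m)) ⟧        ≈⟨ ⟦-⟧ (+ (n ∸ₙ m)) ⟩
    - ℕ⟦ n ∸ₙ m ⟧               ≈⟨ -‿cong (ℕ⟦∸⟧ (ℕ.<⇒≤ (ℕ.≰⇒> n≰m))) ⟩
    - (ℕ⟦ n ⟧ - ℕ⟦ m ⟧)          ≈⟨ ⁻¹-anti-homo‿- _ _ ⟩
    ℕ⟦ m ⟧ - ℕ⟦ n ⟧              ∎

  ⟦+⟧ : ∀ i j → ⟦ i ℤ.+ j ⟧ ≈ ⟦ i ⟧ + ⟦ j ⟧
  ⟦+⟧ -[1+ m ] -[1+ n ] = begin
    - ℕ⟦ suc (suc (m +ₙ n)) ⟧        ≡⟨ ≡.cong (λ k → - ℕ⟦ suc k ⟧) (ℕ.+-suc m n) ⟨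
    - ℕ⟦ suc m +ₙ suc n ⟧            ≈⟨ -‿cong (×-homo-+ 1# (suc m) (suc n)) ⟩
    - (ℕ⟦ suc m ⟧ + ℕ⟦ suc n ⟧)       ≈⟨ ⁻¹-∙-comm _ _ ⟨
    - ℕ⟦ suc m ⟧ + - ℕ⟦ suc n ⟧       ∎
  ⟦+⟧ -[1+ m ] (+ n)    = trans (⟦⊖⟧ n (suc m)) (+-comm _ _)
  ⟦+⟧ (+ m)    -[1+ n ] = ⟦⊖⟧ m (suc n)
  ⟦+⟧ (+ m)    (+ n)    = ×-homo-+ 1# m n

  ⟦◃⟧ : ∀ s n → ⟦ s ◃ n ⟧ ≈ σ⟦ s ⟧ * ℕ⟦ n ⟧
  ⟦◃⟧ s        zero    = sym (zeroʳ _)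
  ⟦◃⟧ Sign.+   (suc n) = sym (*-identityˡ _)
  ⟦◃⟧ Sign.-   (suc n) = sym (-1*x≈-x _)

  ⟦⟧≈σ*ℕ⟦⟧ : ∀ i → ⟦ i ⟧ ≈ σ⟦ sign i ⟧ * ℕ⟦ ∣ i ∣ ⟧
  ⟦⟧≈σ*ℕ⟦⟧ i = trans (reflexive (≡.cong ⟦_⟧ (≡.sym (ℤ.◃-inverse i)))) (⟦◃⟧ (sign i) ∣ i ∣)

  σ⟦*⟧ : ∀ s t → σ⟦ s Sign.* t ⟧ ≈ σ⟦ s ⟧ * σ⟦ t ⟧
  σ⟦*⟧ Sign.+ t      = sym (*-identityˡ _)
  σ⟦*⟧ Sign.- Sign.+ = sym (*-identityʳ _)
  σ⟦*⟧ Sign.- Sign.- = sym (trans (-1*x≈-x (- 1#)) (⁻¹-involutive 1#))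

  ⟦*⟧ : ∀ i j → ⟦ i ℤ.* j ⟧ ≈ ⟦ i ⟧ * ⟦ j ⟧
  ⟦*⟧ i j = begin
    ⟦ i ℤ.* j ⟧
      ≈⟨ ⟦◃⟧ (sign i Sign.* sign j) (∣ i ∣ *ₙ ∣ j ∣) ⟩
    σ⟦ sign i Sign.* sign j ⟧ * ℕ⟦ ∣ i ∣ *ₙ ∣ j ∣ ⟧
      ≈⟨ *-cong (σ⟦*⟧ (sign i) (sign j)) (×1-homo-* ∣ i ∣ ∣ j ∣) ⟩
    (σ⟦ sign i ⟧ * σ⟦ sign j ⟧) * (ℕ⟦ ∣ i ∣ ⟧ * ℕ⟦ ∣ j ∣ ⟧)
      ≈⟨ interchange _ _ _ _ ⟩
    (σ⟦ sign i ⟧ * ℕ⟦ ∣ i ∣ ⟧) * (σ⟦ sign j ⟧ * ℕ⟦ ∣ j ∣ ⟧)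
      ≈⟨ *-cong (⟦⟧≈σ*ℕ⟦⟧ i) (⟦⟧≈σ*ℕ⟦⟧ j) ⟨
    ⟦ i ⟧ * ⟦ j ⟧ ∎

  private
    R′ : AlmostCommutativeRing c ℓ
    R′ = fromCommutativeRing R

  ℤ-homomorphism : ℤ.+-*-rawRing -Raw-AlmostCommutative⟶ R′
  ℤ-homomorphism = record
    { ⟦_⟧ = ⟦_⟧ ; +-homo = ⟦+⟧ ; *-homo = ⟦*⟧ ; -‿homo = ⟦-⟧ ; 0-homo = refl ; 1-homo = refl }

  ⟦⟧-≟ : WeaklyDecidable (Induced-equivalence ℤ-homomorphism)
  ⟦⟧-≟ i j with i ℤ.≟ j
  ... | yes i≡j = just (reflexive (≡.cong ⟦_⟧ i≡j))
  ... | no  _   = nothing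

  open import Algebra.Solver.Ring ℤ.+-*-rawRing R′ ℤ-homomorphism ⟦⟧-≟ public
    using (solve; _:+_; _:*_; _:-_; :-_; _:=_; con)

module QEulerNumbers {c ℓ} (R : CommutativeRing c ℓ) where
  open CommutativeRing R
  open Ops R
  open import Algebra.Properties.Ring ring using (-1*x≈-x)
  open import Algebra.Properties.Group +-group using (x∙y⁻¹≈ε⇒x≈y; x≈y⇒x∙y⁻¹≈ε)
  open import Relation.Binary.Reasoning.Setoid setoid

  open IntegerCoefficientRingSolver R using (solve; _:+_; _:*_; _:-_; :-_; _:=_; con)

  x≈0⇒y*x≈0 : ∀ y {x} → x ≈ 0# → y * x ≈ 0#
  x≈0⇒y*x≈0 y x≈0 = trans (*-congˡ x≈0) (zeroʳ y)

  ^-congˡ : ∀ n {x y} → x ≈ y → x ^ n ≈ y ^ n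
  ^-congˡ zero    x≈y = refl
  ^-congˡ (suc n) x≈y = *-cong x≈y (^-congˡ n x≈y)

  ^-homo-* : ∀ x m n → x ^ (m +ₙ n) ≈ x ^ m * x ^ n
  ^-homo-* x zero    n = sym (*-identityˡ _)
  ^-homo-* x (suc m) n = trans (*-congˡ (^-homo-* x m n)) (sym (*-assoc _ _ _))

  ^-distrib-* : ∀ x y n → (x * y) ^ n ≈ x ^ n * y ^ n
  ^-distrib-* x y zero    = sym (*-identityʳ 1#)
  ^-distrib-* x y (suc n) = trans (*-congˡ (^-distrib-* x y n))
    (solve 4 (λ x y a b → (x :* y) :* (a :* b) := (x :* a) :* (y :* b)) refl x y (x ^ n) (y ^ n))

  1^n≈1 : ∀ n → 1# ^ n ≈ 1#
  1^n≈1 zero    = refl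
  1^n≈1 (suc n) = trans (*-identityˡ _) (1^n≈1 n)

  sgn-even : ∀ k → sgn (2 *ₙ k) ≈ 1#
  sgn-even k = begin
    sgn (k +ₙ (k +ₙ 0))       ≈⟨ reflexive (≡.cong (λ j → sgn (k +ₙ j)) (ℕ.+-identityʳ k)) ⟩
    sgn (k +ₙ k)              ≈⟨ ^-homo-* (- 1#) k k ⟩
    sgn k * sgn k             ≈⟨ sym (^-distrib-* (- 1#) (- 1#) k) ⟩
    (- 1# * - 1#) ^ k         ≈⟨ ^-congˡ k (solve 0 (:- con 1ℤ :* :- con 1ℤ := con 1ℤ) refl) ⟩
    1# ^ k                    ≈⟨ 1^n≈1 k ⟩
    1#                        ∎

  Σ≤-cong : ∀ n {f g : ℕ → Carrier} → (∀ l → l ≤ n → f l ≈ g l) → Σ≤ n f ≈ Σ≤ n g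
  Σ≤-cong zero    f≈g = f≈g 0 z≤n
  Σ≤-cong (suc n) f≈g = +-cong (Σ≤-cong n (λ l l≤n → f≈g l (ℕ.m≤n⇒m≤1+n l≤n))) (f≈g (suc n) ℕ.≤-refl)

  Σ≤-distrib-+ : ∀ n f g → Σ≤ n (λ l → f l + g l) ≈ Σ≤ n f + Σ≤ n g
  Σ≤-distrib-+ zero    f g = refl
  Σ≤-distrib-+ (suc n) f g = trans (+-congʳ (Σ≤-distrib-+ n f g))
    (solve 4 (λ a b c d → (a :+ b) :+ (c :+ d) := (a :+ c) :+ (b :+ d)) refl _ _ _ _)

  *-distribˡ-Σ≤ : ∀ n a f → a * Σ≤ n f ≈ Σ≤ n (λ l → a * f l)
  *-distribˡ-Σ≤ zero    a f = refl
  *-distribˡ-Σ≤ (suc n) a f = trans (distribˡ a _ _) (+-congʳ (*-distribˡ-Σ≤ n a f))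

  Σ≤-suc : ∀ n f → Σ≤ (suc n) f ≈ f 0 + Σ≤ n (λ l → f (suc l))
  Σ≤-suc zero    f = refl
  Σ≤-suc (suc n) f = trans (+-congʳ (Σ≤-suc n f)) (+-assoc _ _ _)

  binom-pascal : ∀ n l → binom (suc n) (suc l) ≈ binom n l + binom n (suc l)
  binom-pascal n l = trans (reflexive (≡.cong ι (≡.sym (nCk+nC[k+1]≡[n+1]C[k+1] n l))))
                           (ι-+ (n C l) (n C suc l))
    where
    ι-+ : ∀ a b → ι (a +ₙ b) ≈ ι a + ι b
    ι-+ zero    b = sym (+-identityˡ _)
    ι-+ (suc a) b = trans (+-congˡ (ι-+ a b)) (sym (+-assoc _ _ _))

  binom-n-suc-n : ∀ n → binom n (suc n) ≈ 0#
  binom-n-suc-n n = reflexive (≡.cong ι (k>n⇒nCk≡0 (ℕ.n<1+n n)))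

  Σ≤-binom-suc : ∀ n (f : ℕ → Carrier) → Σ≤ (suc n) (λ l → binom (suc n) l * f l)
                       ≈ Σ≤ n (λ l → binom n l * f l) + Σ≤ n (λ l → binom n l * f (suc l))
  Σ≤-binom-suc n f = begin
    Σ≤ (suc n) (λ l → binom (suc n) l * f l)
      ≈⟨ Σ≤-suc n (λ l → binom (suc n) l * f l) ⟩
    binom n 0 * f 0 + Σ≤ n (λ l → binom (suc n) (suc l) * f (suc l))
      ≈⟨ +-congˡ (Σ≤-cong n (λ l _ → trans (*-congʳ (binom-pascal n l)) (distribʳ _ _ _))) ⟩
    binom n 0 * f 0 + Σ≤ n (λ l → binom n l * f (suc l) + binom n (suc l) * f (suc l))
      ≈⟨ +-congˡ (Σ≤-distrib-+ n _ _) ⟩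
    binom n 0 * f 0 + (Σ≤ n (λ l → binom n l * f (suc l)) + Σ≤ n (λ l → binom n (suc l) * f (suc l)))
      ≈⟨ solve 3 (λ h a b → h :+ (a :+ b) := (h :+ b) :+ a) refl _ _ _ ⟩
    (binom n 0 * f 0 + Σ≤ n (λ l → binom n (suc l) * f (suc l))) + Σ≤ n (λ l → binom n l * f (suc l))
      ≈⟨ +-congʳ (sym (Σ≤-suc n (λ l → binom n l * f l))) ⟩
    Σ≤ (suc n) (λ l → binom n l * f l) + Σ≤ n (λ l → binom n l * f (suc l))
      ≈⟨ +-congʳ (+-congˡ (trans (*-congʳ (binom-n-suc-n n)) (zeroˡ _))) ⟩
    (Σ≤ n (λ l → binom n l * f l) + 0#) + Σ≤ n (λ l → binom n l * f (suc l))
      ≈⟨ +-congʳ (+-identityʳ _) ⟩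
    Σ≤ n (λ l → binom n l * f l) + Σ≤ n (λ l → binom n l * f (suc l)) ∎

  δ : ℕ → Carrier
  δ zero    = 1#
  δ (suc _) = 0#

  -- BT a b u n is the umbral power (a E + b)ⁿ u, read at 0, where E shifts u;
  -- that is, Σₗ C(n,l) aˡ bⁿ⁻ˡ u l.
  BT : Carrier → Carrier → (ℕ → Carrier) → ℕ → Carrier
  BT a b u zero    = u 0
  BT a b u (suc n) = b * BT a b u n + a * BT a b (λ i → u (suc i)) n

  BT-cong : ∀ {a a′ b b′ u v} → a ≈ a′ → b ≈ b′ → (∀ i → u i ≈ v i) → ∀ n → BT a b u n ≈ BT a′ b′ v n
  BT-cong a≈a′ b≈b′ u≈v zero    = u≈v 0
  BT-cong a≈a′ b≈b′ u≈v (suc n) =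
    +-cong (*-cong b≈b′ (BT-cong a≈a′ b≈b′ u≈v n)) (*-cong a≈a′ (BT-cong a≈a′ b≈b′ (λ i → u≈v (suc i)) n))

  BT-congʳ : ∀ {a b u v} → (∀ i → u i ≈ v i) → ∀ n → BT a b u n ≈ BT a b v n
  BT-congʳ = BT-cong refl refl

  module _ (a b : Carrier) where

    BT-+ : ∀ n u v → BT a b (λ i → u i + v i) n ≈ BT a b u n + BT a b v n
    BT-+ zero    u v = refl
    BT-+ (suc n) u v = trans (+-cong (*-congˡ (BT-+ n u _)) (*-congˡ (BT-+ n _ _)))
      (solve 6 (λ b a x y z w → b :* (x :+ y) :+ a :* (z :+ w) := (b :* x :+ a :* z) :+ (b :* y :+ a :* w))
             refl b a _ _ _ _)

    BT-* : ∀ n x u → BT a b (λ i → x * u i) n ≈ x * BT a b u n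
    BT-* zero    x u = refl
    BT-* (suc n) x u = trans (+-cong (*-congˡ (BT-* n x u)) (*-congˡ (BT-* n x _)))
      (solve 5 (λ b a x y z → b :* (x :* y) :+ a :* (x :* z) := x :* (b :* y :+ a :* z)) refl b a x _ _)

    BT-neg : ∀ n u → BT a b (λ i → - u i) n ≈ - BT a b u n
    BT-neg n u = begin
      BT a b (λ i → - u i) n       ≈⟨ BT-congʳ (λ i → sym (-1*x≈-x (u i))) n ⟩
      BT a b (λ i → - 1# * u i) n  ≈⟨ BT-* n (- 1#) u ⟩
      - 1# * BT a b u n            ≈⟨ -1*x≈-x _ ⟩
      - BT a b u n                 ∎

    BT-const : ∀ n x → BT a b (λ _ → x) n ≈ x * (a + b) ^ n
    BT-const zero    x = sym (*-identityʳ x)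
    BT-const (suc n) x = trans (+-cong (*-congˡ (BT-const n x)) (*-congˡ (BT-const n x)))
      (solve 4 (λ b a x y → b :* (x :* y) :+ a :* (x :* y) := x :* ((a :+ b) :* y)) refl b a x _)

    BT-δ : ∀ n → BT a b δ n ≈ b ^ n
    BT-δ zero    = refl
    BT-δ (suc n) = begin
      b * BT a b δ n + a * BT a b (λ _ → 0#) n
        ≈⟨ +-cong (*-congˡ (BT-δ n)) (x≈0⇒y*x≈0 a (trans (BT-const n 0#) (zeroˡ _))) ⟩
      b * b ^ n + 0#
        ≈⟨ +-identityʳ _ ⟩
      b ^ suc n ∎

    BT-vanishing : ∀ n u → (∀ {j} → j < n → u j ≈ 0#) → BT a b u n ≈ a ^ n * u n
    BT-vanishing zero    u below = sym (*-identityˡ _)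
    BT-vanishing (suc n) u below = begin
      b * BT a b u n + a * BT a b (λ i → u (suc i)) n
        ≈⟨ +-cong (x≈0⇒y*x≈0 b (trans (BT-vanishing n u (λ j<n → below (ℕ.m<n⇒m<1+n j<n)))
                                      (x≈0⇒y*x≈0 _ (below (ℕ.n<1+n n)))))
                  (*-congˡ (BT-vanishing n _ (λ j<n → below (s≤s j<n)))) ⟩
      0# + a * (a ^ n * u (suc n))  ≈⟨ trans (+-identityˡ _) (sym (*-assoc _ _ _)) ⟩
      a ^ suc n * u (suc n)         ∎

  -- a (c E + d) + b = (a c) E + (a d + b)
  BT-∘ : ∀ a b c d n u → BT a b (BT c d u) n ≈ BT (a * c) (a * d + b) u n
  BT-∘ a b c d zero    u = refl
  BT-∘ a b c d (suc n) u = begin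
    b * BT a b (BT c d u) n + a * BT a b (λ i → d * BT c d u i + c * BT c d (λ j → u (suc j)) i) n
      ≈⟨ +-congˡ (*-congˡ (trans (BT-+ a b n _ _) (+-cong (BT-* a b n d _) (BT-* a b n c _)))) ⟩
    b * BT a b (BT c d u) n + a * (d * BT a b (BT c d u) n + c * BT a b (BT c d (λ j → u (suc j))) n)
      ≈⟨ +-cong (*-congˡ (BT-∘ a b c d n u))
                (*-congˡ (+-cong (*-congˡ (BT-∘ a b c d n u)) (*-congˡ (BT-∘ a b c d n _)))) ⟩
    b * X + a * (d * X + c * Y)
      ≈⟨ solve 6 (λ a b c d x y → b :* x :+ a :* (d :* x :+ c :* y) := (a :* d :+ b) :* x :+ (a :* c) :* y)
               refl a b c d X Y ⟩
    (a * d + b) * X + (a * c) * Y ∎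
    where
    X Y : Carrier
    X = BT (a * c) (a * d + b) u n
    Y = BT (a * c) (a * d + b) (λ j → u (suc j)) n

  Σ≤-binom≈BT : ∀ a n u → Σ≤ n (λ l → binom n l * (a ^ l * u l)) ≈ BT a 1# u n
  Σ≤-binom≈BT a zero    u = solve 1 (λ x → (con 1ℤ :+ con (+ 0)) :* (con 1ℤ :* x) := x) refl (u 0)
  Σ≤-binom≈BT a (suc n) u = begin
    Σ≤ (suc n) (λ l → binom (suc n) l * (a ^ l * u l))
      ≈⟨ Σ≤-binom-suc n (λ l → a ^ l * u l) ⟩
    Σ≤ n (λ l → binom n l * (a ^ l * u l)) + Σ≤ n (λ l → binom n l * ((a * a ^ l) * u (suc l)))
      ≈⟨ +-congˡ (Σ≤-cong n (λ l _ → solve 4 (λ c a x y → c :* ((a :* x) :* y) := a :* (c :* (x :* y)))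
                                              refl (binom n l) a (a ^ l) (u (suc l)))) ⟩
    Σ≤ n (λ l → binom n l * (a ^ l * u l)) + Σ≤ n (λ l → a * (binom n l * (a ^ l * u (suc l))))
      ≈⟨ +-cong (trans (Σ≤-binom≈BT a n u) (sym (*-identityˡ _)))
                (trans (sym (*-distribˡ-Σ≤ n a _)) (*-congˡ (Σ≤-binom≈BT a n _))) ⟩
    1# * BT a 1# u n + a * BT a 1# (λ i → u (suc i)) n ∎

  Σ≤-binom-sgn≈0 : ∀ s → 0 < s → Σ≤ s (λ l → binom s l * sgn l) ≈ 0#
  Σ≤-binom-sgn≈0 (suc s) _ = begin
    Σ≤ (suc s) (λ l → binom (suc s) l * sgn l)
      ≈⟨ Σ≤-cong (suc s) (λ l _ → *-congˡ (sym (*-identityʳ _))) ⟩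
    Σ≤ (suc s) (λ l → binom (suc s) l * (sgn l * 1#))
      ≈⟨ Σ≤-binom≈BT (- 1#) (suc s) _ ⟩
    BT (- 1#) 1# (λ _ → 1#) (suc s)
      ≈⟨ BT-const (- 1#) 1# (suc s) 1# ⟩
    1# * ((- 1# + 1#) * (- 1# + 1#) ^ s)
      ≈⟨ solve 1 (λ p → con 1ℤ :* ((:- con 1ℤ :+ con 1ℤ) :* p) := con (+ 0)) refl _ ⟩
    0# ∎

  -- Σₗ C(s,l) (−1)ˡ (a E + 1)^(t+s−l) = (a E + 1)ᵗ ((a E + 1) − 1)ˢ = aˢ Eˢ (a E + 1)ᵗ.
  Σ≤-binom-sgn-BT : ∀ a u s t → Σ≤ s (λ l → binom s l * (sgn l * BT a 1# u (t +ₙ s ∸ₙ l)))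
                                ≈ a ^ s * BT a 1# (λ i → u (i +ₙ s)) t
  Σ≤-binom-sgn-BT a u zero t = begin
    (1# + 0#) * (1# * BT a 1# u (t +ₙ 0))
      ≈⟨ solve 1 (λ x → (con 1ℤ :+ con (+ 0)) :* (con 1ℤ :* x) := con 1ℤ :* x) refl _ ⟩
    1# * BT a 1# u (t +ₙ 0)
      ≈⟨ *-congˡ (reflexive (≡.cong (BT a 1# u) (ℕ.+-identityʳ t))) ⟩
    1# * BT a 1# u t
      ≈⟨ *-congˡ (BT-congʳ (λ i → reflexive (≡.cong u (≡.sym (ℕ.+-identityʳ i)))) t) ⟩
    1# * BT a 1# (λ i → u (i +ₙ 0)) t ∎
  Σ≤-binom-sgn-BT a u (suc s) t = begin
    Σ≤ (suc s) (λ l → binom (suc s) l * (sgn l * BT a 1# u (t +ₙ suc s ∸ₙ l)))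
      ≈⟨ Σ≤-binom-suc s (λ l → sgn l * BT a 1# u (t +ₙ suc s ∸ₙ l)) ⟩
    Σ≤ s (λ l → binom s l * (sgn l * BT a 1# u (t +ₙ suc s ∸ₙ l)))
      + Σ≤ s (λ l → binom s l * ((- 1# * sgn l) * BT a 1# u (t +ₙ suc s ∸ₙ suc l)))
      ≈⟨ +-cong (Σ≤-cong s (λ l _ → *-congˡ (*-congˡ (BT-at (≡.cong (_∸ₙ l) t+1+s≡1+t+s)))))
                (trans (Σ≤-cong s (λ l _ → trans (*-congˡ (*-congˡ (BT-at (≡.cong (_∸ₙ suc l) t+1+s≡1+t+s))))
                          (solve 4 (λ b m g e → b :* ((m :* g) :* e) := m :* (b :* (g :* e)))
                                 refl (binom s l) (- 1#) (sgn l) _)))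
                       (sym (*-distribˡ-Σ≤ s (- 1#) _))) ⟩
    Σ≤ s (λ l → binom s l * (sgn l * BT a 1# u (suc t +ₙ s ∸ₙ l)))
      + - 1# * Σ≤ s (λ l → binom s l * (sgn l * BT a 1# u (t +ₙ s ∸ₙ l)))
      ≈⟨ +-cong (Σ≤-binom-sgn-BT a u s (suc t)) (*-congˡ (Σ≤-binom-sgn-BT a u s t)) ⟩
    a ^ s * (1# * A + a * B) + - 1# * (a ^ s * A)
      ≈⟨ solve 4 (λ p a x y → p :* (con 1ℤ :* x :+ a :* y) :+ :- con 1ℤ :* (p :* x) := (a :* p) :* y)
               refl (a ^ s) a A B ⟩
    a ^ suc s * B
      ≈⟨ *-congˡ (BT-congʳ (λ i → reflexive (≡.cong u (≡.sym (ℕ.+-suc i s)))) t) ⟩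
    a ^ suc s * BT a 1# (λ i → u (i +ₙ suc s)) t ∎
    where
    A B : Carrier
    A = BT a 1# (λ i → u (i +ₙ s)) t
    B = BT a 1# (λ i → u (suc i +ₙ s)) t
    t+1+s≡1+t+s : t +ₙ suc s ≡.≡ suc t +ₙ s
    t+1+s≡1+t+s = ℕ.+-suc t s
    BT-at : ∀ {m n} → m ≡.≡ n → BT a 1# u m ≈ BT a 1# u n
    BT-at m≡n = reflexive (≡.cong (BT a 1# u) m≡n)

  EulerEquation : Carrier → (ℕ → Carrier) → Set ℓ
  EulerEquation Q u = ∀ n → Q * BT Q 1# u n + u n ≈ (1# + Q) * δ n

  IsQEuler⇒EulerEquation : ∀ {Q u} → IsQEuler Q u → EulerEquation Q u
  IsQEuler⇒EulerEquation {Q} {u} euler zero = begin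
    Q * u 0 + u 0    ≈⟨ +-cong (*-congˡ (IsQEuler.init euler)) (IsQEuler.init euler) ⟩
    Q * 1# + 1#      ≈⟨ solve 1 (λ x → x :* con 1ℤ :+ con 1ℤ := (con 1ℤ :+ x) :* con 1ℤ) refl Q ⟩
    (1# + Q) * 1#    ∎
  IsQEuler⇒EulerEquation {Q} {u} euler (suc n) = begin
    Q * BT Q 1# u (suc n) + u (suc n)
      ≈⟨ +-congʳ (*-congˡ (sym (Σ≤-binom≈BT Q (suc n) u))) ⟩
    Q * Σ≤ (suc n) (λ l → binom (suc n) l * (Q ^ l * u l)) + u (suc n)
      ≈⟨ IsQEuler.rec euler n ⟩
    0#
      ≈⟨ sym (zeroʳ _) ⟩
    (1# + Q) * 0# ∎

  -- Apply (c E + d)ⁿ to the Euler equation.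
  EulerEquation-BT : ∀ {Q ξ} → EulerEquation Q ξ →
                     ∀ c d n → Q * BT (c * Q) (c + d) ξ n + BT c d ξ n ≈ (1# + Q) * d ^ n
  EulerEquation-BT {Q} {ξ} euler c d n = begin
    Q * BT (c * Q) (c + d) ξ n + BT c d ξ n
      ≈⟨ +-congʳ (*-congˡ (BT-cong refl (+-congʳ (sym (*-identityʳ c))) (λ _ → refl) n)) ⟩
    Q * BT (c * Q) (c * 1# + d) ξ n + BT c d ξ n
      ≈⟨ +-congʳ (*-congˡ (sym (BT-∘ c d Q 1# n ξ))) ⟩
    Q * BT c d (BT Q 1# ξ) n + BT c d ξ n
      ≈⟨ +-congʳ (sym (BT-* c d n Q _)) ⟩
    BT c d (λ i → Q * BT Q 1# ξ i) n + BT c d ξ n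
      ≈⟨ sym (BT-+ c d n _ _) ⟩
    BT c d (λ i → Q * BT Q 1# ξ i + ξ i) n
      ≈⟨ BT-congʳ euler n ⟩
    BT c d (λ i → (1# + Q) * δ i) n
      ≈⟨ BT-* c d n _ δ ⟩
    (1# + Q) * BT c d δ n
      ≈⟨ *-congˡ (BT-δ c d n) ⟩
    (1# + Q) * d ^ n ∎

  Regular : Carrier → Set (c ⊔ ℓ)
  Regular x = ∀ a → x * a ≈ 0# → a ≈ 0#

  Regular-factor : ∀ {x y z} → Regular x → x ≈ y * z → Regular z
  Regular-factor {x} {y} {z} regular x≈yz a za≈0 = regular a (begin
    x * a        ≈⟨ *-congʳ x≈yz ⟩
    y * z * a    ≈⟨ *-assoc y z a ⟩
    y * (z * a)  ≈⟨ x≈0⇒y*x≈0 y za≈0 ⟩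
    0#           ∎)

  Regular-1+inverse^ : ∀ {q q⁻¹} → q * q⁻¹ ≈ 1# → ∀ n → Regular (1# + q ^ n) → Regular (1# + q⁻¹ ^ n)
  Regular-1+inverse^ {q} {q⁻¹} q*q⁻¹≈1 n regular = Regular-factor regular (begin
    1# + q ^ n                   ≈⟨ +-comm 1# _ ⟩
    q ^ n + 1#                   ≈⟨ +-congˡ (sym (trans (^-congˡ n q*q⁻¹≈1) (1^n≈1 n))) ⟩
    q ^ n + (q * q⁻¹) ^ n        ≈⟨ +-congˡ (^-distrib-* q q⁻¹ n) ⟩
    q ^ n + q ^ n * q⁻¹ ^ n      ≈⟨ sym (trans (distribˡ _ _ _) (+-congʳ (*-identityʳ _))) ⟩
    q ^ n * (1# + q⁻¹ ^ n)       ∎)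

  -- If a difference of solutions vanishes below n, then by BT-vanishing its
  -- equation at n reads (1 + Qⁿ⁺¹) (u n − v n) ≈ 0.
  EulerEquation-unique : ∀ {Q u v} → (∀ n → Regular (1# + Q ^ suc n)) →
                         EulerEquation Q u → EulerEquation Q v → ∀ n → u n ≈ v n
  EulerEquation-unique {Q} {u} {v} regular eu ev n = x∙y⁻¹≈ε⇒x≈y (u n) (v n) (<-rec (λ m → w m ≈ 0#) w≈0 n)
    where
    w : ℕ → Carrier
    w m = u m - v m

    homogeneous : ∀ m → Q * BT Q 1# w m + w m ≈ 0#
    homogeneous m = begin
      Q * BT Q 1# w m + w m
        ≈⟨ +-congʳ (*-congˡ (trans (BT-+ Q 1# m u _) (+-congˡ (BT-neg Q 1# m v)))) ⟩
      Q * (BT Q 1# u m - BT Q 1# v m) + (u m - v m)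
        ≈⟨ solve 5 (λ q a b x y → q :* (a :- b) :+ (x :- y) := (q :* a :+ x) :- (q :* b :+ y)) refl Q _ _ _ _ ⟩
      (Q * BT Q 1# u m + u m) - (Q * BT Q 1# v m + v m)
        ≈⟨ x≈y⇒x∙y⁻¹≈ε (trans (eu m) (sym (ev m))) ⟩
      0# ∎

    w≈0 : ∀ m → (∀ {j} → j < m → w j ≈ 0#) → w m ≈ 0#
    w≈0 m below = regular m (w m) (begin
      (1# + Q * Q ^ m) * w m
        ≈⟨ solve 3 (λ q p x → (con 1ℤ :+ q :* p) :* x := q :* (p :* x) :+ x) refl Q (Q ^ m) (w m) ⟩
      Q * (Q ^ m * w m) + w m
        ≈⟨ +-congʳ (*-congˡ (sym (BT-vanishing Q 1# m w below))) ⟩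
      Q * BT Q 1# w m + w m
        ≈⟨ homogeneous m ⟩
      0# ∎)

  module Symmetry (q q⁻¹ : Carrier) (q*q⁻¹≈1 : q * q⁻¹ ≈ 1#) (regular : ∀ n → Regular (1# + q ^ suc n))
                  (ξ ξ⁻¹ : ℕ → Carrier) (euler : IsQEuler q ξ) (euler⁻¹ : IsQEuler q⁻¹ ξ⁻¹) where

    η : ℕ → Carrier
    η = BT (- 1#) 1# ξ

    ρ : ℕ → Carrier
    ρ n = η n - (1# + q) + (q * q + q) * δ n

    q*η+BTq⁻¹η : ∀ n → q * η n + BT q⁻¹ 1# η n ≈ (1# + q) * (q⁻¹ + 1#) ^ n
    q*η+BTq⁻¹η n = begin
      q * η n + BT q⁻¹ 1# η n
        ≈⟨ +-congˡ (BT-∘ q⁻¹ 1# (- 1#) 1# n ξ) ⟩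
      q * η n + BT (q⁻¹ * - 1#) (q⁻¹ * 1# + 1#) ξ n
        ≈⟨ +-congʳ (*-congˡ (BT-cong (sym a*q≈-1) (sym a+b≈1) (λ _ → refl) n)) ⟩
      q * BT (a * q) (a + b) ξ n + BT a b ξ n
        ≈⟨ EulerEquation-BT (IsQEuler⇒EulerEquation euler) a b n ⟩
      (1# + q) * b ^ n
        ≈⟨ *-congˡ (^-congˡ n (+-congʳ (*-identityʳ q⁻¹))) ⟩
      (1# + q) * (q⁻¹ + 1#) ^ n ∎
      where
      a b : Carrier
      a = q⁻¹ * - 1#
      b = q⁻¹ * 1# + 1#
      a*q≈-1 : a * q ≈ - 1#
      a*q≈-1 = trans (solve 3 (λ i m x → (i :* m) :* x := m :* (x :* i)) refl q⁻¹ (- 1#) q)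
                     (trans (*-congˡ q*q⁻¹≈1) (*-identityʳ _))
      a+b≈1 : a + b ≈ 1#
      a+b≈1 = solve 1 (λ i → i :* :- con 1ℤ :+ (i :* con 1ℤ :+ con 1ℤ) := con 1ℤ) refl q⁻¹

    q⁻²ρ-EulerEquation : EulerEquation q⁻¹ (λ n → (q⁻¹ * q⁻¹) * ρ n)
    q⁻²ρ-EulerEquation n = begin
      q⁻¹ * BT q⁻¹ 1# (λ m → (q⁻¹ * q⁻¹) * ρ m) n + (q⁻¹ * q⁻¹) * ρ n
        ≈⟨ +-congʳ (*-congˡ (trans (BT-* q⁻¹ 1# n _ ρ) (*-congˡ BTρ))) ⟩
      q⁻¹ * ((q⁻¹ * q⁻¹) * (X + - (1# + q) * D + (q * q + q))) + (q⁻¹ * q⁻¹) * ρ n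
        -- an identity modulo the relations q q⁻¹ ≈ 1 and q*η+BTq⁻¹η n
        ≈⟨ solve 6 (λ i x e X D z →
              i :* ((i :* i) :* (X :+ :- (con 1ℤ :+ x) :* D :+ (x :* x :+ x)))
                :+ (i :* i) :* (e :- (con 1ℤ :+ x) :+ (x :* x :+ x) :* z)
              := (con 1ℤ :+ i) :* z
                :+ ((x :* i :- con 1ℤ) :* (i :* i :* x :+ i :* i :- i :* i :* e :+ (i :* x :+ con 1ℤ :+ i) :* z)
                    :+ (i :* i :* i) :* ((x :* e :+ X) :- (con 1ℤ :+ x) :* D)))
              refl q⁻¹ q (η n) X D (δ n) ⟩
      (1# + q⁻¹) * δ n + ((q * q⁻¹ - 1#) * P + (q⁻¹ * q⁻¹ * q⁻¹) * ((q * η n + X) - (1# + q) * D))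
        ≈⟨ +-congˡ (+-cong (trans (*-congʳ (x≈y⇒x∙y⁻¹≈ε q*q⁻¹≈1)) (zeroˡ _))
                           (x≈0⇒y*x≈0 _ (x≈y⇒x∙y⁻¹≈ε (q*η+BTq⁻¹η n)))) ⟩
      (1# + q⁻¹) * δ n + (0# + 0#)
        ≈⟨ trans (+-congˡ (+-identityʳ 0#)) (+-identityʳ _) ⟩
      (1# + q⁻¹) * δ n ∎
      where
      X D P : Carrier
      X = BT q⁻¹ 1# η n
      D = (q⁻¹ + 1#) ^ n
      P = q⁻¹ * q⁻¹ * q + q⁻¹ * q⁻¹ - q⁻¹ * q⁻¹ * η n + (q⁻¹ * q + 1# + q⁻¹) * δ n
      BTρ : BT q⁻¹ 1# ρ n ≈ X + - (1# + q) * D + (q * q + q)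
      BTρ = begin
        BT q⁻¹ 1# ρ n
          ≈⟨ trans (BT-+ q⁻¹ 1# n _ _) (+-cong (BT-+ q⁻¹ 1# n η _) (BT-* q⁻¹ 1# n _ δ)) ⟩
        X + BT q⁻¹ 1# (λ _ → - (1# + q)) n + (q * q + q) * BT q⁻¹ 1# δ n
          ≈⟨ +-cong (+-congˡ (BT-const q⁻¹ 1# n _)) (*-congˡ (trans (BT-δ q⁻¹ 1# n) (1^n≈1 n))) ⟩
        X + - (1# + q) * D + (q * q + q) * 1#
          ≈⟨ +-congˡ (*-identityʳ _) ⟩
        X + - (1# + q) * D + (q * q + q) ∎

    q²ξ⁻¹≈ρ : ∀ n → (q * q) * ξ⁻¹ n ≈ ρ n
    q²ξ⁻¹≈ρ n = begin
      (q * q) * ξ⁻¹ n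
        ≈⟨ *-congˡ (EulerEquation-unique regular⁻¹ (IsQEuler⇒EulerEquation euler⁻¹) q⁻²ρ-EulerEquation n) ⟩
      (q * q) * ((q⁻¹ * q⁻¹) * ρ n)
        ≈⟨ solve 3 (λ x i r → (x :* x) :* ((i :* i) :* r) := (x :* i) :* ((x :* i) :* r)) refl q q⁻¹ (ρ n) ⟩
      (q * q⁻¹) * ((q * q⁻¹) * ρ n)
        ≈⟨ trans (*-cong q*q⁻¹≈1 (*-congʳ q*q⁻¹≈1)) (trans (*-identityˡ _) (*-identityˡ _)) ⟩
      ρ n ∎
      where
      regular⁻¹ : ∀ n → Regular (1# + q⁻¹ ^ suc n)
      regular⁻¹ n = Regular-1+inverse^ q*q⁻¹≈1 (suc n) (regular n)

    q²ξ⁻¹≈η-[1+q] : ∀ n → 0 < n → (q * q) * ξ⁻¹ n ≈ η n - (1# + q)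
    q²ξ⁻¹≈η-[1+q] (suc n) _ = trans (q²ξ⁻¹≈ρ (suc n)) (trans (+-congˡ (zeroʳ _)) (+-identityʳ _))

    alternating-sum : ∀ N → 0 < N → Σ≤ N (λ l → binom N l * (sgn l * ξ l)) ≈ (q * q) * ξ⁻¹ N + (1# + q)
    alternating-sum N 0<N = begin
      Σ≤ N (λ l → binom N l * (sgn l * ξ l))  ≈⟨ Σ≤-binom≈BT (- 1#) N ξ ⟩
      η N                                     ≈⟨ solve 2 (λ e x → e := (e :- x) :+ x) refl (η N) (1# + q) ⟩
      (η N - (1# + q)) + (1# + q)             ≈⟨ +-congʳ (sym (q²ξ⁻¹≈η-[1+q] N 0<N)) ⟩
      (q * q) * ξ⁻¹ N + (1# + q)              ∎

    alternating-sum-shifted : ∀ N s → 0 < s → s < N → sgn s ≈ 1# →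
      Σ≤ (N ∸ₙ s) (λ l → binom (N ∸ₙ s) l * (sgn l * ξ (l +ₙ s)))
      ≈ (q * q) * Σ≤ s (λ l → binom s l * (sgn (l +ₙ s) * ξ⁻¹ (N ∸ₙ l)))
    alternating-sum-shifted N s 0<s s<N sgn-s≈1 = sym (begin
      (q * q) * Σ≤ s (λ l → binom s l * (sgn (l +ₙ s) * ξ⁻¹ (N ∸ₙ l)))
        ≈⟨ *-distribˡ-Σ≤ s _ _ ⟩
      Σ≤ s (λ l → (q * q) * (binom s l * (sgn (l +ₙ s) * ξ⁻¹ (N ∸ₙ l))))
        ≈⟨ Σ≤-cong s summand ⟩
      Σ≤ s (λ l → binom s l * (sgn l * η (t +ₙ s ∸ₙ l)) + - (1# + q) * (binom s l * sgn l))
        ≈⟨ Σ≤-distrib-+ s _ _ ⟩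
      Σ≤ s (λ l → binom s l * (sgn l * η (t +ₙ s ∸ₙ l))) + Σ≤ s (λ l → - (1# + q) * (binom s l * sgn l))
        ≈⟨ +-cong (Σ≤-binom-sgn-BT (- 1#) ξ s t) (sym (*-distribˡ-Σ≤ s _ _)) ⟩
      sgn s * BT (- 1#) 1# (λ i → ξ (i +ₙ s)) t + - (1# + q) * Σ≤ s (λ l → binom s l * sgn l)
        ≈⟨ +-cong (trans (*-congʳ sgn-s≈1) (*-identityˡ _)) (x≈0⇒y*x≈0 _ (Σ≤-binom-sgn≈0 s 0<s)) ⟩
      BT (- 1#) 1# (λ i → ξ (i +ₙ s)) t + 0#
        ≈⟨ trans (+-identityʳ _) (sym (Σ≤-binom≈BT (- 1#) t _)) ⟩
      Σ≤ t (λ l → binom t l * (sgn l * ξ (l +ₙ s))) ∎)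
      where
      t : ℕ
      t = N ∸ₙ s
      N≡t+s : N ≡.≡ t +ₙ s
      N≡t+s = ≡.sym (ℕ.m∸n+n≡m (ℕ.<⇒≤ s<N))
      sgn[l+s]≈sgn-l : ∀ l → sgn (l +ₙ s) ≈ sgn l
      sgn[l+s]≈sgn-l l = trans (^-homo-* (- 1#) l s) (trans (*-congˡ sgn-s≈1) (*-identityʳ _))
      summand : ∀ l → l ≤ s → (q * q) * (binom s l * (sgn (l +ₙ s) * ξ⁻¹ (N ∸ₙ l)))
                          ≈ binom s l * (sgn l * η (t +ₙ s ∸ₙ l)) + - (1# + q) * (binom s l * sgn l)
      summand l l≤s = begin
        (q * q) * (binom s l * (sgn (l +ₙ s) * ξ⁻¹ (N ∸ₙ l)))
          ≈⟨ *-congˡ (*-congˡ (*-congʳ (sgn[l+s]≈sgn-l l))) ⟩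
        (q * q) * (binom s l * (sgn l * ξ⁻¹ (N ∸ₙ l)))
          ≈⟨ solve 4 (λ x b g y → x :* (b :* (g :* y)) := b :* (g :* (x :* y))) refl _ _ _ _ ⟩
        binom s l * (sgn l * ((q * q) * ξ⁻¹ (N ∸ₙ l)))
          ≈⟨ *-congˡ (*-congˡ (q²ξ⁻¹≈η-[1+q] (N ∸ₙ l) (ℕ.m<n⇒0<n∸m (ℕ.≤-<-trans l≤s s<N)))) ⟩
        binom s l * (sgn l * (η (N ∸ₙ l) - (1# + q)))
          ≈⟨ *-congˡ (*-congˡ (+-congʳ (reflexive (≡.cong (λ m → η (m ∸ₙ l)) N≡t+s)))) ⟩
        binom s l * (sgn l * (η (t +ₙ s ∸ₙ l) - (1# + q)))
          ≈⟨ solve 4 (λ b g e x → b :* (g :* (e :- x)) := b :* (g :* e) :+ :- x :* (b :* g)) refl _ _ _ _ ⟩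
        binom s l * (sgn l * η (t +ₙ s ∸ₙ l)) + - (1# + q) * (binom s l * sgn l) ∎

theorem8 : ∀ {c ℓ} (R : CommutativeRing c ℓ) →
    let open CommutativeRing R
        open Ops R
    in
    (q q⁻¹ : Carrier) → q * q⁻¹ ≈ 1# →
    (∀ n a → (1# + q ^ (n +ₙ 1)) * a ≈ 0# → a ≈ 0#) →
    (ξq ξq⁻¹ : ℕ → Carrier) → IsQEuler q ξq → IsQEuler q⁻¹ ξq⁻¹ →
    (∀ m n k → 0 < k → 2 *ₙ k < m +ₙ n →
      Σ≤ (m +ₙ n ∸ₙ 2 *ₙ k) (λ l → binom (n +ₙ m ∸ₙ 2 *ₙ k) l * (sgn l * ξq (l +ₙ 2 *ₙ k)))
      ≈ (q * q) * Σ≤ (2 *ₙ k) (λ l → binom (2 *ₙ k) l * (sgn (l +ₙ 2 *ₙ k) * ξq⁻¹ (n +ₙ m ∸ₙ l))))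
    ×
    (∀ m n → 0 < m +ₙ n →
      Σ≤ (m +ₙ n) (λ l → binom (n +ₙ m) l * (sgn l * ξq l))
      ≈ (q * q) * ξq⁻¹ (n +ₙ m) + (1# + q))
theorem8 R q q⁻¹ q*q⁻¹≈1 cancel ξ ξ⁻¹ euler euler⁻¹ =
    (λ m n k 0<k 2k<m+n →
      trans (reflexive (≡.cong₂ Σ≤ (≡.cong (_∸ₙ 2 *ₙ k) (ℕ.+-comm m n)) ≡.refl))
            (alternating-sum-shifted (n +ₙ m) (2 *ₙ k) (ℕ.*-monoʳ-< 2 0<k)
              (≡.subst (2 *ₙ k <_) (ℕ.+-comm m n) 2k<m+n) (sgn-even k)))
  , (λ m n 0<m+n →
      trans (reflexive (≡.cong₂ Σ≤ (ℕ.+-comm m n) ≡.refl))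
            (alternating-sum (n +ₙ m) (≡.subst (0 <_) (ℕ.+-comm m n) 0<m+n)))
  where
  open CommutativeRing R using (_+_; 1#; trans; reflexive)
  open Ops R using (_^_; Σ≤)
  open QEulerNumbers R

  regular : ∀ n → Regular (1# + q ^ suc n)
  regular n = ≡.subst (λ j → Regular (1# + q ^ j)) (ℕ.+-comm n 1) (cancel n)

  open Symmetry q q⁻¹ q*q⁻¹≈1 regular ξ ξ⁻¹ euler euler⁻¹
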